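{- Consider an instance of the Maximum Coverage Problem with Cluster Constraints and the linear relaxation of its mixed integer formulation, as described in the context. Then there is an optimal solution $(x^*,y^*,z^*)$ of this linear relaxation such that for every cluster $l\in\mathcal{C}$ and every $k\in\mathcal{K}(l)=\{1,\dots,n_l\}$ (ordered by non-increasing capacity, with critical knapsack $\kappa_l$): $z^*_{kl}=B_k/U_l$ if $k<\kappa_l$, $z^*_{kl}=1-\sum_{t=1}^{\kappa_l-1}z^*_{tl}$ if $k=\kappa_l$, and $z^*_{kl}=0$ otherwise.
   Context: Instance: items $\mathcal{I}=[n]$ with profits $p_i>0$; sets $S_1,\dots,S_m\subseteq\mathcal{I}$ (identified with $\mathcal{S}=[m]$) with costs $c_j>0$; knapsacks $\mathcal{K}=[p]$ with capacities $B_k>0$, partitioned into clusters $\mathcal{C}=[q]$; $\mathcal{K}(l)$ denotes the knapsacks of cluster $l$, which has capacity $U_l>0$. Standing assumptions: for every cluster $l$, $B_k\le U_l$ for all $k\in\mathcal{K}(l)$, and $\sum_{k\in\mathcal{K}(l)}B_k>U_l$. The knapsacks of each cluster $l$ are indexed $\mathcal{K}(l)=\{1,\dots,n_l\}$ in order of non-increasing capacity (ties broken arbitrarily). The critical knapsack $\kappa_l\in\mathcal{K}(l)$ is the one with $\sum_{k=1}^{\kappa_l-1}B_k\le U_l<\sum_{k=1}^{\kappa_l}B_k$. Let $\mathcal{S}(i)=\{j:i\in S_j\}$. The linear relaxation has variables $x_{jk}\in[0,1]$ for $j\in\mathcal{S}$, $k\in\mathcal{K}$ with $B_k\ge c_j$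 (others absent, i.e. $0$), $y_i\in[0,1]$ for $i\in\mathcal{I}$, and $z_{kl}\ge0$ for $l\in\mathcal{C}$, $k\in\mathcal{K}(l)$; it maximizes $\sum_ip_iy_i$ subject to $\sum_jc_jx_{jk}\le B_k$ ($k\in\mathcal{K}$), $\sum_kx_{jk}\le1$ ($j\in\mathcal{S}$), $\sum_{j\in\mathcal{S}(i)}\sum_kx_{jk}\ge y_i$ ($i\in\mathcal{I}$), $\sum_jc_jx_{jk}\le U_lz_{kl}$ ($l\in\mathcal{C}$, $k\in\mathcal{K}(l)$), and $\sum_{k\in\mathcal{K}(l)}z_{kl}\le1$ ($l\in\mathcal{C}$).
   Formalization: The profits $p_i$, costs $c_j$ and capacities $B_k$, $U_l$ are rational, and the variables of the linear relaxation are taken in ℚ, with optimality judged only against rational feasible points. -}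

module Defs where

open import Data.Bool using (Bool; true; false; if_then_else_)
open import Data.Nat as ℕ using (ℕ; zero; suc)
open import Data.Fin as Fin using (Fin; toℕ)
open import Data.Product using (Σ; _×_; _,_)
open import Data.Rational using (ℚ; 0ℚ; 1ℚ; _+_; _*_; _-_; _≤_; _<_; _÷_; >-nonZero)
open import Relation.Binary.PropositionalEquality using (_≡_)

Σℚ : ∀ {n} → (Fin n → ℚ) → ℚ
Σℚ {zero}  f = 0ℚ
Σℚ {suc n} f = f Fin.zero + Σℚ (λ i → f (Fin.suc i))

-- Sum of f t over the indices t with toℕ t < b  (i.e. 1-based indices 1..b).
Σbelow : ∀ {n} → (Fin n → ℚ) → ℕ → ℚ
Σbelow f b = Σℚ (λ t → if toℕ t ℕ.<ᵇ b then f t else 0ℚ)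

-- Knapsacks are represented cluster by cluster: cluster l has nK l knapsacks,
-- indexed by Fin (nK l) in the order of non-increasing capacity
-- (Fin index t corresponds to the paper's index t+1).
record Instance : Set where
  field
    n m q   : ℕ
    profit  : Fin n → ℚ
    mem     : Fin m → Fin n → Bool        -- mem j i = true  iff  i ∈ S_j
    cost    : Fin m → ℚ
    nK      : Fin q → ℕ
    B       : (l : Fin q) → Fin (nK l) → ℚ
    U       : Fin q → ℚ
    profit-pos : ∀ i → 0ℚ < profit i
    cost-pos   : ∀ j → 0ℚ < cost j
    B-pos      : ∀ l k → 0ℚ < B l k
    U-pos      : ∀ l → 0ℚ < U l
    B≤U        : ∀ l k → B l k ≤ U l
    U<ΣB       : ∀ l → U l < Σℚ (B l)
    B-nonincr  : ∀ l (a b : Fin (nK l)) → a Fin.≤ b → B l b ≤ B l a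

module _ (I : Instance) where
  open Instance I

  Knap : Set
  Knap = Σ (Fin q) (λ l → Fin (nK l))

  ΣK : (Knap → ℚ) → ℚ
  ΣK f = Σℚ (λ l → Σℚ (λ k → f (l , k)))

  capOf : Knap → ℚ
  capOf (l , k) = B l k

  IsCritical : (l : Fin q) → Fin (nK l) → Set
  IsCritical l κ = (Σbelow (B l) (toℕ κ) ≤ U l) × (U l < Σbelow (B l) (suc (toℕ κ)))

  record Point : Set where
    field
      x : Fin m → Knap → ℚ
      y : Fin n → ℚ
      z : (l : Fin q) → Fin (nK l) → ℚ

  load : Point → Knap → ℚ
  load P k = Σℚ (λ j → cost j * Point.x P j k)

  objective : Point → ℚ
  objective P = Σℚ (λ i → profit i * Point.y P i)

  record Feasible (P : Point) : Set where
    open Point P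
    field
      x-bounds  : ∀ j k → (0ℚ ≤ x j k) × (x j k ≤ 1ℚ)
      -- variables x_jk with B_k < c_j are absent, i.e. fixed to 0
      x-absent  : ∀ j k → capOf k < cost j → x j k ≡ 0ℚ
      y-bounds  : ∀ i → (0ℚ ≤ y i) × (y i ≤ 1ℚ)
      z-nonneg  : ∀ l k → 0ℚ ≤ z l k
      knapsack  : ∀ k → load P k ≤ capOf k
      assign    : ∀ j → ΣK (x j) ≤ 1ℚ
      cover     : ∀ i → y i ≤ Σℚ (λ j → if mem j i then ΣK (x j) else 0ℚ)
      cluster   : ∀ l k → load P (l , k) ≤ U l * z l k
      z-sum     : ∀ l → Σℚ (z l) ≤ 1ℚ

  Optimal : Point → Set
  Optimal P = Feasible P × (∀ P′ → Feasible P′ → objective P′ ≤ objective P)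

  zShape : Point → (l : Fin q) → Fin (nK l) → Set
  zShape P l κ = ∀ (k : Fin (nK l)) →
      (toℕ k ℕ.< toℕ κ → Point.z P l k ≡ _÷_ (B l k) (U l) {{>-nonZero (U-pos l)}})
    × (k ≡ κ → Point.z P l k ≡ 1ℚ - Σbelow (Point.z P l) (toℕ κ))
    × (toℕ κ ℕ.< toℕ k → Point.z P l k ≡ 0ℚ)

-- Fixing z to the greedy profile loses nothing.  Lay the knapsacks of cluster l end to end in
-- index order and let z_kl be U_l⁻¹ times the part of [0, U_l] covered by knapsack k; this is the
-- shape in the statement, κ_l being where U_l is reached.  The loads of any feasible point, laid
-- end to end in the same way, fill an interval of length at most U_l, and sending to knapsack k
-- the load lying over its share moves load only to knapsacks of smaller index (larger capacity),
-- keeps every x_j's total, and makes every cluster constraint hold with the greedy z.  So the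
-- linear program in (x, y) with z greedy has the optimal value of the relaxation; it is feasible
-- and bounded, hence by Fourier–Motzkin elimination it attains its maximum.

module Submission where

open import Data.Bool using (true; false; if_then_else_; T)
open import Data.Empty using (⊥-elim)
open import Data.Fin as Fin using (Fin; toℕ)
open import Data.List using (List; []; _∷_; _++_; [_]; map; concatMap; allFin)
import Data.List.Relation.Unary.All as All
open import Data.List.Relation.Unary.Any as Any using (here; there)
open import Data.List.Membership.Propositional using (_∈_; _∉_; find; lose)
open import Data.List.Membership.Propositional.Properties
  using (∈-++⁺ˡ; ∈-++⁺ʳ; ∈-++⁻; ∈-map⁺; ∈-map⁻; ∈-allFin; ∈-concatMap⁺; ∈-concatMap⁻)
open import Data.Nat as ℕ using (ℕ; zero; suc)
import Data.Nat.Properties as ℕ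
open import Data.Product using (Σ; ∃; _×_; _,_; proj₁; proj₂)
import Data.Product.Properties as ×
open import Data.Rational hiding (truncate)
open import Data.Rational.Properties
open import Data.Rational.Solver using (module +-*-Solver)
open import Data.Sum using (_⊎_; inj₁; inj₂)
import Data.Sum.Properties as ⊎
open import Data.Unit using (⊤; tt)
import Data.Unit.Properties as ⊤
open import Function using (_∘_)
open import Relation.Binary using (tri<; tri≈; tri>; DecidableEquality; DecTotalOrder)
open import Relation.Binary.PropositionalEquality hiding ([_])
open import Relation.Nullary using (Dec; yes; no; does; contradiction)
open import Relation.Nullary.Decidable using (map′)

open import Data.List.Extrema (DecTotalOrder.totalOrder ≤-decTotalOrder)
  using (min; max; min≤v⁺; v≤min⁺; v≤max⁺; max≤v⁺)
open import Defs

open +-*-Solver using (solve; _:=_; _:+_; _:-_; _:*_; :-_; con)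

≤-rebalance : ∀ {p q r s} → r ≤ s → p + s ≡ q + r → p ≤ q
≤-rebalance {p} {q} {r} {s} r≤s eq = begin
  p            ≡⟨ solve 2 (λ p s → p := (p :+ s) :- s) refl p s ⟩
  (p + s) - s  ≡⟨ cong (_- s) eq ⟩
  (q + r) - s  ≤⟨ +-monoˡ-≤ (- s) (+-monoʳ-≤ q r≤s) ⟩
  (q + s) - s  ≡⟨ solve 2 (λ q s → (q :+ s) :- s := q) refl q s ⟩
  q            ∎
  where open ≤-Reasoning

p≤q⇒0≤q-p : ∀ {p q} → p ≤ q → 0ℚ ≤ q - p
p≤q⇒0≤q-p {p} {q} p≤q = ≤-rebalance p≤q (solve 2 (λ p q → con 0ℚ :+ q := (q :- p) :+ p) refl p q)

p-q≤0⇒p≤q : ∀ {p q} → p - q ≤ 0ℚ → p ≤ q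
p-q≤0⇒p≤q {p} {q} p-q≤0 = ≤-rebalance p-q≤0 (solve 2 (λ p q → p :+ con 0ℚ := q :+ (p :- q)) refl p q)

p≤q⇒p-q≤0 : ∀ {p q} → p ≤ q → p - q ≤ 0ℚ
p≤q⇒p-q≤0 {p} {q} p≤q = ≤-rebalance p≤q (solve 2 (λ p q → (p :- q) :+ q := con 0ℚ :+ p) refl p q)

0≤1 : 0ℚ ≤ 1ℚ
0≤1 = nonNegative⁻¹ 1ℚ

[p+q]-p≡q : ∀ p q → (p + q) - p ≡ q
[p+q]-p≡q = solve 2 (λ p q → (p :+ q) :- p := q) refl

*-÷-cancel : ∀ p .{{_ : NonZero p}} q → p * (q ÷ p) ≡ q
*-÷-cancel p q = begin-equality
  p * (q * (1/ p))  ≡⟨ solve 3 (λ p q i → p :* (q :* i) := q :* (p :* i)) refl p q (1/ p) ⟩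
  q * (p * (1/ p))  ≡⟨ cong (q *_) (*-inverseʳ p) ⟩
  q * 1ℚ            ≡⟨ *-identityʳ q ⟩
  q                 ∎
  where open ≤-Reasoning

≤-bound⇒≤-pos : ∀ {α t r b} .{{_ : NonZero α}} → 0ℚ < α → t ≤ (b - r) ÷ α → α * t + r ≤ b
≤-bound⇒≤-pos {α} {t} {r} {b} α>0 t≤ = begin
  α * t + r              ≤⟨ +-monoˡ-≤ r (*-monoˡ-≤-nonNeg α {{nonNegative (<⇒≤ α>0)}} t≤) ⟩
  α * ((b - r) ÷ α) + r  ≡⟨ cong (_+ r) (*-÷-cancel α (b - r)) ⟩
  (b - r) + r            ≡⟨ solve 2 (λ b r → (b :- r) :+ r := b) refl b r ⟩
  b                      ∎
  where open ≤-Reasoning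

≤⇒≤-bound-pos : ∀ {α t r b} .{{_ : NonZero α}} → 0ℚ < α → α * t + r ≤ b → t ≤ (b - r) ÷ α
≤⇒≤-bound-pos {α} {t} {r} {b} α>0 h = *-cancelˡ-≤-pos α {{positive α>0}} (begin
  α * t              ≤⟨ ≤-rebalance h (solve 3 (λ at r b → at :+ b := (b :- r) :+ (at :+ r)) refl (α * t) r b) ⟩
  b - r              ≡⟨ *-÷-cancel α (b - r) ⟨
  α * ((b - r) ÷ α)  ∎)
  where open ≤-Reasoning

≥-bound⇒≤-neg : ∀ {α t r b} .{{_ : NonZero α}} → α < 0ℚ → (b - r) ÷ α ≤ t → α * t + r ≤ b
≥-bound⇒≤-neg {α} {t} {r} {b} α<0 t≥ = begin
  α * t + r              ≤⟨ +-monoˡ-≤ r (*-monoˡ-≤-nonPos α {{nonPositive (<⇒≤ α<0)}} t≥) ⟩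
  α * ((b - r) ÷ α) + r  ≡⟨ cong (_+ r) (*-÷-cancel α (b - r)) ⟩
  (b - r) + r            ≡⟨ solve 2 (λ b r → (b :- r) :+ r := b) refl b r ⟩
  b                      ∎
  where open ≤-Reasoning

≤-combine : ∀ {α e t r s b c} → 0ℚ < α → e < 0ℚ → α * t + r ≤ b → e * t + s ≤ c →
            (- e) * r + α * s ≤ (- e) * b + α * c
≤-combine {α} {e} {t} {r} {s} {b} {c} α>0 e<0 h₁ h₂ = begin
  (- e) * r + α * s                        ≡⟨ solve 5 (λ a e t r s → (:- e) :* r :+ a :* s := (:- e) :* (a :* t :+ r) :+ a :* (e :* t :+ s)) refl α e t r s ⟩
  (- e) * (α * t + r) + α * (e * t + s)    ≤⟨ +-mono-≤ (*-monoˡ-≤-nonNeg (- e) {{nonNegative (<⇒≤ (neg-antimono-< e<0))}} h₁)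
                                                        (*-monoˡ-≤-nonNeg α {{nonNegative (<⇒≤ α>0)}} h₂) ⟩
  (- e) * b + α * c                        ∎
  where open ≤-Reasoning

combined⇒lower≤upper : ∀ {α e r s b c} .{{_ : NonZero α}} .{{_ : NonZero e}} → 0ℚ < α → e < 0ℚ →
                       (- e) * r + α * s ≤ (- e) * b + α * c → (c - s) ÷ e ≤ (b - r) ÷ α
combined⇒lower≤upper {α} {e} {r} {s} {b} {c} α>0 e<0 h =
  *-cancelˡ-≤-pos ((- e) * α) {{pos*pos⇒pos (- e) {{positive (neg-antimono-< e<0)}} α {{positive α>0}}}} (begin
    ((- e) * α) * ℓ   ≡⟨ solve 3 (λ e a l → (:- e :* a) :* l := :- (a :* (e :* l))) refl e α ℓ ⟩
    - (α * (e * ℓ))   ≡⟨ cong (λ w → - (α * w)) (*-÷-cancel e (c - s)) ⟩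
    - (α * (c - s))   ≤⟨ ≤-rebalance h (solve 6 (λ e a r s b c → :- (a :* (c :- s)) :+ ((:- e) :* b :+ a :* c) := (:- e) :* (b :- r) :+ ((:- e) :* r :+ a :* s)) refl e α r s b c) ⟩
    (- e) * (b - r)   ≡⟨ cong ((- e) *_) (*-÷-cancel α (b - r)) ⟨
    (- e) * (α * u)   ≡⟨ *-assoc (- e) α u ⟨
    ((- e) * α) * u   ∎)
  where
    open ≤-Reasoning
    ℓ = (c - s) ÷ e
    u = (b - r) ÷ α

Σℚ-cong : ∀ {n} {f g : Fin n → ℚ} → (∀ i → f i ≡ g i) → Σℚ f ≡ Σℚ g
Σℚ-cong {zero}  f≗g = refl
Σℚ-cong {suc n} f≗g = cong₂ _+_ (f≗g Fin.zero) (Σℚ-cong (λ i → f≗g (Fin.suc i)))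

Σℚ-mono : ∀ {n} {f g : Fin n → ℚ} → (∀ i → f i ≤ g i) → Σℚ f ≤ Σℚ g
Σℚ-mono {zero}  f≤g = ≤-refl
Σℚ-mono {suc n} f≤g = +-mono-≤ (f≤g Fin.zero) (Σℚ-mono (λ i → f≤g (Fin.suc i)))

Σℚ-zero : ∀ n → Σℚ {n} (λ _ → 0ℚ) ≡ 0ℚ
Σℚ-zero zero    = refl
Σℚ-zero (suc n) = cong (0ℚ +_) (Σℚ-zero n)

Σℚ-nonNeg : ∀ {n} {f : Fin n → ℚ} → (∀ i → 0ℚ ≤ f i) → 0ℚ ≤ Σℚ f
Σℚ-nonNeg {n} {f} f≥0 = subst (_≤ Σℚ f) (Σℚ-zero n) (Σℚ-mono f≥0)

Σℚ-distrib-+ : ∀ {n} (f g : Fin n → ℚ) → Σℚ (λ i → f i + g i) ≡ Σℚ f + Σℚ g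
Σℚ-distrib-+ {zero}  f g = refl
Σℚ-distrib-+ {suc n} f g =
  trans (cong (f Fin.zero + g Fin.zero +_) (Σℚ-distrib-+ (λ i → f (Fin.suc i)) (λ i → g (Fin.suc i))))
        (solve 4 (λ a b c d → (a :+ b) :+ (c :+ d) := (a :+ c) :+ (b :+ d)) refl
               (f Fin.zero) (g Fin.zero) (Σℚ (λ i → f (Fin.suc i))) (Σℚ (λ i → g (Fin.suc i))))

*-distribˡ-Σℚ : ∀ {n} c (f : Fin n → ℚ) → Σℚ (λ i → c * f i) ≡ c * Σℚ f
*-distribˡ-Σℚ {zero}  c f = sym (*-zeroʳ c)
*-distribˡ-Σℚ {suc n} c f = trans (cong (c * f Fin.zero +_) (*-distribˡ-Σℚ c (λ i → f (Fin.suc i))))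
                                  (sym (*-distribˡ-+ c (f Fin.zero) _))

*-distribʳ-Σℚ : ∀ {n} c (f : Fin n → ℚ) → Σℚ (λ i → f i * c) ≡ Σℚ f * c
*-distribʳ-Σℚ c f = trans (Σℚ-cong (λ i → *-comm (f i) c)) (trans (*-distribˡ-Σℚ c f) (*-comm c _))

Σℚ-comm : ∀ {n m} (f : Fin n → Fin m → ℚ) → Σℚ (λ i → Σℚ (f i)) ≡ Σℚ (λ j → Σℚ (λ i → f i j))
Σℚ-comm {zero}  {m} f = sym (Σℚ-zero m)
Σℚ-comm {suc n} {m} f = trans (cong (Σℚ (f Fin.zero) +_) (Σℚ-comm (λ i → f (Fin.suc i))))
                              (sym (Σℚ-distrib-+ (f Fin.zero) (λ j → Σℚ (λ i → f (Fin.suc i) j))))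

term≤Σℚ : ∀ {n} {f : Fin n → ℚ} → (∀ i → 0ℚ ≤ f i) → ∀ i → f i ≤ Σℚ f
term≤Σℚ {suc n} {f} f≥0 Fin.zero =
  subst (_≤ Σℚ f) (+-identityʳ (f Fin.zero)) (+-monoʳ-≤ (f Fin.zero) (Σℚ-nonNeg (λ i → f≥0 (Fin.suc i))))
term≤Σℚ {suc n} {f} f≥0 (Fin.suc i) =
  subst (_≤ Σℚ f) (+-identityˡ _) (+-mono-≤ (f≥0 Fin.zero) (term≤Σℚ (λ i → f≥0 (Fin.suc i)) i))

Σℚ-telescope : ∀ n (g : ℕ → ℚ) → Σℚ {n} (λ k → g (suc (toℕ k)) - g (toℕ k)) ≡ g n - g 0
Σℚ-telescope zero    g = sym (+-inverseʳ (g 0))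
Σℚ-telescope (suc n) g = trans (cong (g 1 - g 0 +_) (Σℚ-telescope n (λ t → g (suc t))))
                               (solve 3 (λ a b c → (b :- a) :+ (c :- b) := c :- a) refl (g 0) (g 1) (g (suc n)))

Σbelow-zero : ∀ {n} (f : Fin n → ℚ) → Σbelow f 0 ≡ 0ℚ
Σbelow-zero {n} f = Σℚ-zero n

Σbelow-suc : ∀ {n} (f : Fin n → ℚ) (k : Fin n) → Σbelow f (suc (toℕ k)) ≡ Σbelow f (toℕ k) + f k
Σbelow-suc {suc n} f Fin.zero = begin
  f Fin.zero + Σℚ {n} (λ _ → 0ℚ)        ≡⟨ cong (f Fin.zero +_) (Σℚ-zero n) ⟩
  f Fin.zero + 0ℚ                       ≡⟨ +-comm (f Fin.zero) 0ℚ ⟩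
  0ℚ + f Fin.zero                       ≡⟨ cong (λ s → 0ℚ + s + f Fin.zero) (Σℚ-zero n) ⟨
  0ℚ + Σℚ {n} (λ _ → 0ℚ) + f Fin.zero   ∎
  where open ≡-Reasoning
Σbelow-suc {suc n} f (Fin.suc k) =
  trans (cong (f Fin.zero +_) (Σbelow-suc (λ i → f (Fin.suc i)) k)) (sym (+-assoc (f Fin.zero) _ _))

Σbelow-all : ∀ {n} (f : Fin n → ℚ) → Σbelow f n ≡ Σℚ f
Σbelow-all {zero}  f = refl
Σbelow-all {suc n} f = cong (f Fin.zero +_) (Σbelow-all (λ i → f (Fin.suc i)))

Σbelow-cong : ∀ {n} {f g : Fin n → ℚ} t → (∀ i → toℕ i ℕ.< t → f i ≡ g i) → Σbelow f t ≡ Σbelow g t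
Σbelow-cong {f = f} {g} t f≗g = Σℚ-cong term
  where
    term : ∀ i → (if toℕ i ℕ.<ᵇ t then f i else 0ℚ) ≡ (if toℕ i ℕ.<ᵇ t then g i else 0ℚ)
    term i with toℕ i ℕ.<ᵇ t in i<t
    ... | true  = f≗g i (ℕ.<ᵇ⇒< (toℕ i) t (subst T (sym i<t) _))
    ... | false = refl

Σbelow-monoˡ : ∀ {n} {f g : Fin n → ℚ} t → (∀ i → f i ≤ g i) → Σbelow f t ≤ Σbelow g t
Σbelow-monoˡ {f = f} {g} t f≤g = Σℚ-mono term
  where
    term : ∀ i → (if toℕ i ℕ.<ᵇ t then f i else 0ℚ) ≤ (if toℕ i ℕ.<ᵇ t then g i else 0ℚ)
    term i with toℕ i ℕ.<ᵇ t
    ... | true  = f≤g i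
    ... | false = ≤-refl

Σbelow-monoʳ : ∀ {n} {f : Fin n → ℚ} {a b} → (∀ i → 0ℚ ≤ f i) → a ℕ.≤ b → Σbelow f a ≤ Σbelow f b
Σbelow-monoʳ {f = f} {a} {b} f≥0 a≤b = Σℚ-mono term
  where
    term : ∀ i → (if toℕ i ℕ.<ᵇ a then f i else 0ℚ) ≤ (if toℕ i ℕ.<ᵇ b then f i else 0ℚ)
    term i with toℕ i ℕ.<ᵇ a in i<a | toℕ i ℕ.<ᵇ b in i<b
    ... | false | false = ≤-refl
    ... | false | true  = f≥0 i
    ... | true  | true  = ≤-refl
    ... | true  | false = ⊥-elim (subst T i<b (ℕ.<⇒<ᵇ (ℕ.<-≤-trans (ℕ.<ᵇ⇒< (toℕ i) a (subst T (sym i<a) _)) a≤b)))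

Σbelow-nonNeg : ∀ {n} {f : Fin n → ℚ} t → (∀ i → 0ℚ ≤ f i) → 0ℚ ≤ Σbelow f t
Σbelow-nonNeg {f = f} t f≥0 = subst (_≤ Σbelow f t) (Σbelow-zero f) (Σbelow-monoʳ {b = t} f≥0 ℕ.z≤n)

Σbelow≤Σℚ : ∀ {n} {f : Fin n → ℚ} t → (∀ i → 0ℚ ≤ f i) → Σbelow f t ≤ Σℚ f
Σbelow≤Σℚ {f = f} t f≥0 = Σℚ-mono term
  where
    term : ∀ i → (if toℕ i ℕ.<ᵇ t then f i else 0ℚ) ≤ f i
    term i with toℕ i ℕ.<ᵇ t
    ... | true  = ≤-refl
    ... | false = f≥0 i

*-distribʳ-Σbelow : ∀ {n} c (f : Fin n → ℚ) t → Σbelow (λ i → f i * c) t ≡ Σbelow f t * c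
*-distribʳ-Σbelow c f t = trans (Σℚ-cong term) (*-distribʳ-Σℚ c (λ i → if toℕ i ℕ.<ᵇ t then f i else 0ℚ))
  where
    term : ∀ i → (if toℕ i ℕ.<ᵇ t then f i * c else 0ℚ) ≡ (if toℕ i ℕ.<ᵇ t then f i else 0ℚ) * c
    term i with toℕ i ℕ.<ᵇ t
    ... | true  = refl
    ... | false = sym (*-zeroˡ c)

clamp : ℚ → ℚ → ℚ → ℚ
clamp a b p = b ⊓ (a ⊔ p)

clamp-below : ∀ {a b p} → a ≤ b → p ≤ a → clamp a b p ≡ a
clamp-below {a} {b} {p} a≤b p≤a = trans (cong (b ⊓_) (p≥q⇒p⊔q≡p p≤a)) (p≥q⇒p⊓q≡q a≤b)

clamp-inside : ∀ {a b p} → a ≤ p → p ≤ b → clamp a b p ≡ p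
clamp-inside {a} {b} {p} a≤p p≤b = trans (cong (b ⊓_) (p≤q⇒p⊔q≡q a≤p)) (p≥q⇒p⊓q≡q p≤b)

clamp-above : ∀ {a b p} → a ≤ b → b ≤ p → clamp a b p ≡ b
clamp-above {a} {b} {p} a≤b b≤p = trans (cong (b ⊓_) (p≤q⇒p⊔q≡q (≤-trans a≤b b≤p))) (p≤q⇒p⊓q≡p b≤p)

clamp-mono : ∀ a b {p q} → p ≤ q → clamp a b p ≤ clamp a b q
clamp-mono a b p≤q = ⊓-monoʳ-≤ b (⊔-monoʳ-≤ a p≤q)

-- For a ≤ b and c ≤ d this is the length of [a, b] ∩ [c, d].
overlapLength : ℚ → ℚ → ℚ → ℚ → ℚ
overlapLength a b c d = clamp a b d - clamp a b c

overlapLength-nonNeg : ∀ a b {c d} → c ≤ d → 0ℚ ≤ overlapLength a b c d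
overlapLength-nonNeg a b c≤d = p≤q⇒0≤q-p (clamp-mono a b c≤d)

overlapLength≤length : ∀ {a b} c d → a ≤ b → overlapLength a b c d ≤ b - a
overlapLength≤length {a} {b} c d a≤b = +-mono-≤ (p⊓q≤p b (a ⊔ d)) (neg-antimono-≤ (⊓-glb a≤b (p≤p⊔q a c)))

overlapLength-comm : ∀ {a b c d} → a ≤ b → c ≤ d → overlapLength a b c d ≡ overlapLength c d a b
overlapLength-comm {a} {b} {c} {d} a≤b c≤d with ≤-total c a | ≤-total d a | ≤-total d b | ≤-total c b
... | inj₁ c≤a | inj₁ d≤a | _ | _ =
  trans (trans (cong₂ _-_ (clamp-below a≤b d≤a) (clamp-below a≤b c≤a)) (+-inverseʳ a))
        (sym (trans (cong₂ _-_ (clamp-above c≤d (≤-trans d≤a a≤b)) (clamp-above c≤d d≤a)) (+-inverseʳ d)))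
... | inj₁ c≤a | inj₂ a≤d | inj₁ d≤b | _ =
  trans (cong₂ _-_ (clamp-inside a≤d d≤b) (clamp-below a≤b c≤a))
        (sym (cong₂ _-_ (clamp-above c≤d d≤b) (clamp-inside c≤a a≤d)))
... | inj₁ c≤a | inj₂ a≤d | inj₂ b≤d | _ =
  trans (cong₂ _-_ (clamp-above a≤b b≤d) (clamp-below a≤b c≤a))
        (sym (cong₂ _-_ (clamp-inside (≤-trans c≤a a≤b) b≤d) (clamp-inside c≤a a≤d)))
... | inj₂ a≤c | _ | _ | inj₂ b≤c =
  trans (trans (cong₂ _-_ (clamp-above a≤b (≤-trans b≤c c≤d)) (clamp-above a≤b b≤c)) (+-inverseʳ b))
        (sym (trans (cong₂ _-_ (clamp-below c≤d b≤c) (clamp-below c≤d (≤-trans a≤b b≤c))) (+-inverseʳ c)))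
... | inj₂ a≤c | _ | inj₁ d≤b | inj₁ c≤b =
  trans (cong₂ _-_ (clamp-inside (≤-trans a≤c c≤d) d≤b) (clamp-inside a≤c c≤b))
        (sym (cong₂ _-_ (clamp-above c≤d d≤b) (clamp-below c≤d a≤c)))
... | inj₂ a≤c | _ | inj₂ b≤d | inj₁ c≤b =
  trans (cong₂ _-_ (clamp-above a≤b b≤d) (clamp-inside a≤c c≤b))
        (sym (cong₂ _-_ (clamp-inside c≤b b≤d) (clamp-below c≤d a≤c)))

[p+q]⊓r-p⊓r≤q : ∀ p q r → 0ℚ ≤ q → (p + q) ⊓ r - p ⊓ r ≤ q
[p+q]⊓r-p⊓r≤q p q r q≥0 with ≤-total p r
... | inj₁ p≤r = begin
  (p + q) ⊓ r - p ⊓ r  ≡⟨ cong (λ s → (p + q) ⊓ r - s) (p≤q⇒p⊓q≡p p≤r) ⟩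
  (p + q) ⊓ r - p      ≤⟨ +-monoˡ-≤ (- p) (p⊓q≤p (p + q) r) ⟩
  (p + q) - p          ≡⟨ [p+q]-p≡q p q ⟩
  q                    ∎
  where open ≤-Reasoning
... | inj₂ r≤p = begin
  (p + q) ⊓ r - p ⊓ r  ≡⟨ cong (λ s → (p + q) ⊓ r - s) (p≥q⇒p⊓q≡q r≤p) ⟩
  (p + q) ⊓ r - r      ≤⟨ +-monoˡ-≤ (- r) (p⊓q≤q (p + q) r) ⟩
  r - r                ≡⟨ +-inverseʳ r ⟩
  0ℚ                   ≤⟨ q≥0 ⟩
  q                    ∎
  where open ≤-Reasoning

-- Fourier–Motzkin elimination

pointBetween : (L U : List ℚ) → (∀ {l u} → l ∈ L → u ∈ U → l ≤ u) →
               ∃ λ t → (∀ {l} → l ∈ L → l ≤ t) × (∀ {u} → u ∈ U → t ≤ u)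
pointBetween []       []       _   = 0ℚ , (λ ()) , (λ ())
pointBetween []       (u ∷ us) _   = min u us , (λ ()) , min≤member
  where
    min≤member : ∀ {v} → v ∈ u ∷ us → min u us ≤ v
    min≤member (here refl) = min≤v⁺ u us (inj₁ ≤-refl)
    min≤member (there v∈)  = min≤v⁺ u us (inj₂ (Any.map (λ eq → ≤-reflexive (sym eq)) v∈))
pointBetween (l ∷ ls) U        l≤u = max l ls , member≤max , max≤
  where
    member≤max : ∀ {v} → v ∈ l ∷ ls → v ≤ max l ls
    member≤max (here refl) = v≤max⁺ l ls (inj₁ ≤-refl)
    member≤max (there v∈)  = v≤max⁺ l ls (inj₂ (Any.map ≤-reflexive v∈))
    max≤ : ∀ {u} → u ∈ U → max l ls ≤ u
    max≤ u∈ = max≤v⁺ (l≤u (here refl) u∈) (All.tabulate (λ v∈ → l≤u (there v∈) u∈))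

module FourierMotzkin {V : Set} (_≟_ : DecidableEquality V) where

  LinearForm : Set
  LinearForm = List (V × ℚ)

  Valuation : Set
  Valuation = V → ℚ

  ⟦_⟧ : LinearForm → Valuation → ℚ
  ⟦ []          ⟧ x = 0ℚ
  ⟦ (v , c) ∷ a ⟧ x = c * x v + ⟦ a ⟧ x

  ⟦++⟧ : ∀ a b x → ⟦ a ++ b ⟧ x ≡ ⟦ a ⟧ x + ⟦ b ⟧ x
  ⟦++⟧ []            b x = sym (+-identityˡ _)
  ⟦++⟧ ((v , c) ∷ a) b x = trans (cong (c * x v +_) (⟦++⟧ a b x)) (sym (+-assoc (c * x v) _ _))

  scale : ℚ → LinearForm → LinearForm
  scale s = map (λ (v , c) → v , s * c)

  ⟦scale⟧ : ∀ s a x → ⟦ scale s a ⟧ x ≡ s * ⟦ a ⟧ x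
  ⟦scale⟧ s []            x = sym (*-zeroʳ s)
  ⟦scale⟧ s ((v , c) ∷ a) x = trans (cong (s * c * x v +_) (⟦scale⟧ s a x))
    (solve 4 (λ s c xv r → s :* c :* xv :+ s :* r := s :* (c :* xv :+ r)) refl s c (x v) (⟦ a ⟧ x))

  coeff : V → LinearForm → ℚ
  coeff w []            = 0ℚ
  coeff w ((v , c) ∷ a) = (if does (v ≟ w) then c else 0ℚ) + coeff w a

  without : V → LinearForm → LinearForm
  without w []            = []
  without w ((v , c) ∷ a) = if does (v ≟ w) then without w a else (v , c) ∷ without w a

  _[_≔_] : Valuation → V → ℚ → Valuation
  (x [ w ≔ t ]) v = if does (v ≟ w) then t else x v

  ≔-same : ∀ x w t → (x [ w ≔ t ]) w ≡ t
  ≔-same x w t with w ≟ w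
  ... | yes _   = refl
  ... | no w≢w = ⊥-elim (w≢w refl)

  ≔-other : ∀ x {w v} t → v ≢ w → (x [ w ≔ t ]) v ≡ x v
  ≔-other x {w} {v} t v≢w with v ≟ w
  ... | yes v≡w = ⊥-elim (v≢w v≡w)
  ... | no _    = refl

  ⟦⟧-split : ∀ w a x → ⟦ a ⟧ x ≡ coeff w a * x w + ⟦ without w a ⟧ x
  ⟦⟧-split w []            x = sym (trans (+-identityʳ _) (*-zeroˡ (x w)))
  ⟦⟧-split w ((v , c) ∷ a) x with v ≟ w
  ... | yes refl = trans (cong (c * x v +_) (⟦⟧-split w a x))
    (solve 4 (λ c xv k r → c :* xv :+ (k :* xv :+ r) := (c :+ k) :* xv :+ r) refl c (x v) (coeff w a) (⟦ without w a ⟧ x))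
  ... | no _     = trans (cong (c * x v +_) (⟦⟧-split w a x))
    (solve 5 (λ c xv k xw r → c :* xv :+ (k :* xw :+ r) := (con 0ℚ :+ k) :* xw :+ (c :* xv :+ r)) refl
           c (x v) (coeff w a) (x w) (⟦ without w a ⟧ x))

  ⟦without⟧-≔ : ∀ w a x t → ⟦ without w a ⟧ (x [ w ≔ t ]) ≡ ⟦ without w a ⟧ x
  ⟦without⟧-≔ w []            x t = refl
  ⟦without⟧-≔ w ((v , c) ∷ a) x t with v ≟ w
  ... | yes _ = ⟦without⟧-≔ w a x t
  ... | no v≢w = cong₂ _+_ (cong (c *_) (≔-other x t v≢w)) (⟦without⟧-≔ w a x t)

  ⟦⟧-≔ : ∀ w a x t → ⟦ a ⟧ (x [ w ≔ t ]) ≡ coeff w a * t + ⟦ without w a ⟧ x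
  ⟦⟧-≔ w a x t = trans (⟦⟧-split w a (x [ w ≔ t ]))
                       (cong₂ _+_ (cong (coeff w a *_) (≔-same x w t)) (⟦without⟧-≔ w a x t))

  ⟦⟧-cong : ∀ a {x y} → (∀ v → x v ≡ y v) → ⟦ a ⟧ x ≡ ⟦ a ⟧ y
  ⟦⟧-cong []            x≗y = refl
  ⟦⟧-cong ((v , c) ∷ a) x≗y = cong₂ _+_ (cong (c *_) (x≗y v)) (⟦⟧-cong a x≗y)

  Constraint : Set
  Constraint = LinearForm × ℚ

  _⊨_ : Valuation → Constraint → Set
  x ⊨ (a , b) = ⟦ a ⟧ x ≤ b

  _⊨*_ : Valuation → List Constraint → Set
  x ⊨* S = ∀ {c} → c ∈ S → x ⊨ c

  ⊨*-cong : ∀ S {x y} → (∀ v → x v ≡ y v) → x ⊨* S → y ⊨* S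
  ⊨*-cong S x≗y x⊨S {a , b} c∈ = subst (_≤ b) (⟦⟧-cong a x≗y) (x⊨S c∈)

  -- Eliminating w: keep the constraints free of w and add every positive combination
  -- of an upper bound on w (positive coefficient) with a lower bound on w (negative coefficient).

  combine : V → Constraint → Constraint → Constraint
  combine w (a , b) (d , e) =
    scale (- coeff w d) (without w a) ++ scale (coeff w a) (without w d) , (- coeff w d) * b + coeff w a * e

  ⟦combine⟧ : ∀ w a b d e x → ⟦ proj₁ (combine w (a , b) (d , e)) ⟧ x
                              ≡ (- coeff w d) * ⟦ without w a ⟧ x + coeff w a * ⟦ without w d ⟧ x
  ⟦combine⟧ w a b d e x = trans (⟦++⟧ (scale (- coeff w d) (without w a)) (scale (coeff w a) (without w d)) x)
    (cong₂ _+_ (⟦scale⟧ (- coeff w d) (without w a) x) (⟦scale⟧ (coeff w a) (without w d) x))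

  combineWithLower : V → Constraint → Constraint → List Constraint
  combineWithLower w c (d , e) with <-cmp (coeff w d) 0ℚ
  ... | tri< _ _ _ = [ combine w c (d , e) ]
  ... | tri≈ _ _ _ = []
  ... | tri> _ _ _ = []

  eliminateFrom : V → List Constraint → Constraint → List Constraint
  eliminateFrom w S (a , b) with <-cmp (coeff w a) 0ℚ
  ... | tri< _ _ _ = []
  ... | tri≈ _ _ _ = [ without w a , b ]
  ... | tri> _ _ _ = concatMap (combineWithLower w (a , b)) S

  eliminate : V → List Constraint → List Constraint
  eliminate w S = concatMap (eliminateFrom w S) S

  α≡0⇒α*t+r≡r : ∀ {α} t r → α ≡ 0ℚ → α * t + r ≡ r
  α≡0⇒α*t+r≡r t r refl = trans (cong (_+ r) (*-zeroˡ t)) (+-identityˡ r)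

  combine∈eliminate : ∀ {w S a b d e} → 0ℚ < coeff w a → coeff w d < 0ℚ → (a , b) ∈ S → (d , e) ∈ S →
                      combine w (a , b) (d , e) ∈ eliminate w S
  combine∈eliminate {w} {S} {a} {b} {d} {e} α>0 δ<0 ab∈ de∈ = ∈-concatMap⁺ (eliminateFrom w S) (lose ab∈ fromUpper)
    where
      fromLower : combine w (a , b) (d , e) ∈ combineWithLower w (a , b) (d , e)
      fromLower with <-cmp (coeff w d) 0ℚ
      ... | tri< _ _ _    = here refl
      ... | tri≈ δ≮0 _ _ = contradiction δ<0 δ≮0
      ... | tri> δ≮0 _ _ = contradiction δ<0 δ≮0
      fromUpper : combine w (a , b) (d , e) ∈ eliminateFrom w S (a , b)
      fromUpper with <-cmp (coeff w a) 0ℚ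
      ... | tri> _ _ _    = ∈-concatMap⁺ (combineWithLower w (a , b)) (lose de∈ fromLower)
      ... | tri< _ _ α≯0 = contradiction α>0 α≯0
      ... | tri≈ _ _ α≯0 = contradiction α>0 α≯0

  without∈eliminate : ∀ {w S a b} → coeff w a ≡ 0ℚ → (a , b) ∈ S → (without w a , b) ∈ eliminate w S
  without∈eliminate {w} {S} {a} {b} α≡0 ab∈ = ∈-concatMap⁺ (eliminateFrom w S) (lose ab∈ fromFree)
    where
      fromFree : (without w a , b) ∈ eliminateFrom w S (a , b)
      fromFree with <-cmp (coeff w a) 0ℚ
      ... | tri≈ _ _ _    = here refl
      ... | tri< _ α≢0 _ = contradiction α≡0 α≢0
      ... | tri> _ α≢0 _ = contradiction α≡0 α≢0

  eliminate-sound : ∀ w S x t → x ⊨* S → (x [ w ≔ t ]) ⊨* eliminate w S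
  eliminate-sound w S x t x⊨S c∈ with find (∈-concatMap⁻ (eliminateFrom w S) c∈)
  ... | _ , ab∈ , c∈from = fromConstraint ab∈ c∈from
    where
      split : ∀ {a b} → (a , b) ∈ S → coeff w a * x w + ⟦ without w a ⟧ x ≤ b
      split {a} {b} ab∈ = subst (_≤ b) (⟦⟧-split w a x) (x⊨S ab∈)

      fromPair : ∀ {a b d e c} → 0ℚ < coeff w a → (a , b) ∈ S → (d , e) ∈ S →
                 c ∈ combineWithLower w (a , b) (d , e) → (x [ w ≔ t ]) ⊨ c
      fromPair {a} {b} {d} {e} α>0 ab∈ de∈ c∈ with <-cmp (coeff w d) 0ℚ
      fromPair {a} {b} {d} {e} α>0 ab∈ de∈ (here refl) | tri< δ<0 _ _ = begin
        ⟦ proj₁ (combine w (a , b) (d , e)) ⟧ (x [ w ≔ t ])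
          ≡⟨ ⟦combine⟧ w a b d e (x [ w ≔ t ]) ⟩
        (- coeff w d) * ⟦ without w a ⟧ (x [ w ≔ t ]) + coeff w a * ⟦ without w d ⟧ (x [ w ≔ t ])
          ≡⟨ cong₂ (λ r s → (- coeff w d) * r + coeff w a * s) (⟦without⟧-≔ w a x t) (⟦without⟧-≔ w d x t) ⟩
        (- coeff w d) * ⟦ without w a ⟧ x + coeff w a * ⟦ without w d ⟧ x
          ≤⟨ ≤-combine α>0 δ<0 (split ab∈) (split de∈) ⟩
        (- coeff w d) * b + coeff w a * e ∎
        where open ≤-Reasoning

      fromConstraint : ∀ {a b c} → (a , b) ∈ S → c ∈ eliminateFrom w S (a , b) → (x [ w ≔ t ]) ⊨ c
      fromConstraint {a} {b} ab∈ c∈ with <-cmp (coeff w a) 0ℚ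
      fromConstraint {a} {b} ab∈ (here refl) | tri≈ _ α≡0 _ =
        subst (_≤ b) (trans (α≡0⇒α*t+r≡r (x w) _ α≡0) (sym (⟦without⟧-≔ w a x t))) (split ab∈)
      fromConstraint {a} {b} ab∈ c∈ | tri> _ _ α>0 with find (∈-concatMap⁻ (combineWithLower w (a , b)) c∈)
      ... | _ , de∈ , c∈pair = fromPair α>0 ab∈ de∈ c∈pair

  module Bounds (w : V) (x : Valuation) where

    residual : LinearForm → ℚ
    residual a = ⟦ without w a ⟧ x

    lowerBound : Constraint → List ℚ
    lowerBound (a , b) with <-cmp (coeff w a) 0ℚ
    ... | tri< α<0 _ _ = [ ((b - residual a) ÷ coeff w a) {{<-nonZero α<0}} ]
    ... | tri≈ _ _ _   = []
    ... | tri> _ _ _   = []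

    upperBound : Constraint → List ℚ
    upperBound (a , b) with <-cmp (coeff w a) 0ℚ
    ... | tri< _ _ _   = []
    ... | tri≈ _ _ _   = []
    ... | tri> _ _ α>0 = [ ((b - residual a) ÷ coeff w a) {{>-nonZero α>0}} ]

    lowerBound∋ : ∀ {a b} (α<0 : coeff w a < 0ℚ) → ((b - residual a) ÷ coeff w a) {{<-nonZero α<0}} ∈ lowerBound (a , b)
    lowerBound∋ {a} α<0 with <-cmp (coeff w a) 0ℚ
    ... | tri< _ _ _   = here refl
    ... | tri≈ α≮0 _ _ = contradiction α<0 α≮0
    ... | tri> α≮0 _ _ = contradiction α<0 α≮0

    upperBound∋ : ∀ {a b} (α>0 : 0ℚ < coeff w a) → ((b - residual a) ÷ coeff w a) {{>-nonZero α>0}} ∈ upperBound (a , b)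
    upperBound∋ {a} α>0 with <-cmp (coeff w a) 0ℚ
    ... | tri> _ _ _   = here refl
    ... | tri< _ _ α≯0 = contradiction α>0 α≯0
    ... | tri≈ _ _ α≯0 = contradiction α>0 α≯0

    lowerBound⁻ : ∀ {a b l} → l ∈ lowerBound (a , b) →
                  Σ (coeff w a < 0ℚ) λ α<0 → l ≡ ((b - residual a) ÷ coeff w a) {{<-nonZero α<0}}
    lowerBound⁻ {a} l∈ with <-cmp (coeff w a) 0ℚ
    lowerBound⁻ (here refl) | tri< α<0 _ _ = α<0 , refl
    lowerBound⁻ ()          | tri≈ _ _ _
    lowerBound⁻ ()          | tri> _ _ _

    upperBound⁻ : ∀ {a b u} → u ∈ upperBound (a , b) →
                  Σ (0ℚ < coeff w a) λ α>0 → u ≡ ((b - residual a) ÷ coeff w a) {{>-nonZero α>0}}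
    upperBound⁻ {a} u∈ with <-cmp (coeff w a) 0ℚ
    upperBound⁻ ()          | tri< _ _ _
    upperBound⁻ ()          | tri≈ _ _ _
    upperBound⁻ (here refl) | tri> _ _ α>0 = α>0 , refl

  module Completion (w : V) (S : List Constraint) (x : Valuation) (x⊨ : x ⊨* eliminate w S) where
    open Bounds w x

    lowers uppers : List ℚ
    lowers = concatMap lowerBound S
    uppers = concatMap upperBound S

    lower≤upper : ∀ {l u} → l ∈ lowers → u ∈ uppers → l ≤ u
    lower≤upper l∈ u∈ with find (∈-concatMap⁻ lowerBound {S} l∈) | find (∈-concatMap⁻ upperBound {S} u∈)
    ... | (d , e) , de∈ , l∈d | (a , b) , ab∈ , u∈a with lowerBound⁻ l∈d | upperBound⁻ u∈a
    ... | δ<0 , refl | α>0 , refl =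
      combined⇒lower≤upper {{>-nonZero α>0}} {{<-nonZero δ<0}} α>0 δ<0
        (subst (_≤ _) (⟦combine⟧ w a b d e x) (x⊨ (combine∈eliminate α>0 δ<0 ab∈ de∈)))

    eliminate-complete : ∃ λ t → (x [ w ≔ t ]) ⊨* S
    eliminate-complete with pointBetween lowers uppers lower≤upper
    ... | t , lowers≤t , t≤uppers = t , satisfied
      where
        satisfied : (x [ w ≔ t ]) ⊨* S
        satisfied {a , b} ab∈ with <-cmp (coeff w a) 0ℚ
        ... | tri< α<0 _ _ = subst (_≤ b) (sym (⟦⟧-≔ w a x t))
          (≥-bound⇒≤-neg {{<-nonZero α<0}} α<0 (lowers≤t (∈-concatMap⁺ lowerBound {S} (lose ab∈ (lowerBound∋ α<0)))))
        ... | tri≈ _ α≡0 _ = subst (_≤ b) (sym (trans (⟦⟧-≔ w a x t) (α≡0⇒α*t+r≡r t _ α≡0)))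
          (x⊨ (without∈eliminate α≡0 ab∈))
        ... | tri> _ _ α>0 = subst (_≤ b) (sym (⟦⟧-≔ w a x t))
          (≤-bound⇒≤-pos {{>-nonZero α>0}} α>0 (t≤uppers (∈-concatMap⁺ upperBound {S} (lose ab∈ (upperBound∋ α>0)))))

  open Completion using (eliminate-complete)

  eliminateAll : List V → List Constraint → List Constraint
  eliminateAll []       S = S
  eliminateAll (w ∷ ws) S = eliminateAll ws (eliminate w S)

  zeroOut : List V → Valuation → Valuation
  zeroOut []       x = x
  zeroOut (w ∷ ws) x = zeroOut ws (x [ w ≔ 0ℚ ])

  eliminateAll-sound : ∀ ws S x → x ⊨* S → zeroOut ws x ⊨* eliminateAll ws S
  eliminateAll-sound []       S x x⊨S = x⊨S
  eliminateAll-sound (w ∷ ws) S x x⊨S = eliminateAll-sound ws (eliminate w S) _ (eliminate-sound w S x 0ℚ x⊨S)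

  eliminateAll-complete : ∀ ws S x {o} → o ∉ ws → x ⊨* eliminateAll ws S → ∃ λ y → y ⊨* S × y o ≡ x o
  eliminateAll-complete []       S x o∉ x⊨ = x , x⊨ , refl
  eliminateAll-complete (w ∷ ws) S x o∉ x⊨ with eliminateAll-complete ws (eliminate w S) x (o∉ ∘ there) x⊨
  ... | y , y⊨ , yo≡xo with eliminate-complete w S y y⊨
  ... | t , y[w≔t]⊨ = y [ w ≔ t ] , y[w≔t]⊨ , trans (≔-other y t (o∉ ∘ here)) yo≡xo

  zeroOut-zero : ∀ ws x {v} → x v ≡ 0ℚ → zeroOut ws x v ≡ 0ℚ
  zeroOut-zero []       x xv≡0 = xv≡0
  zeroOut-zero (w ∷ ws) x {v} xv≡0 = zeroOut-zero ws _ zeroed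
    where
      zeroed : (x [ w ≔ 0ℚ ]) v ≡ 0ℚ
      zeroed with v ≟ w
      ... | yes _ = refl
      ... | no _  = xv≡0

  zeroOut-∈ : ∀ ws x {v} → v ∈ ws → zeroOut ws x v ≡ 0ℚ
  zeroOut-∈ (w ∷ ws) x (here refl) = zeroOut-zero ws _ (≔-same x w 0ℚ)
  zeroOut-∈ (w ∷ ws) x (there v∈) = zeroOut-∈ ws _ v∈

  zeroOut-∉ : ∀ ws x {v} → v ∉ ws → zeroOut ws x v ≡ x v
  zeroOut-∉ []       x v∉ = refl
  zeroOut-∉ (w ∷ ws) x v∉ = trans (zeroOut-∉ ws _ (v∉ ∘ there)) (≔-other x 0ℚ (v∉ ∘ here))

  -- Once every variable but o is eliminated, the feasible values of o form an interval
  -- whose right end point is attained.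
  module Maximisation (S : List Constraint) (o : V) (ws : List V) (o∉ws : o ∉ ws)
                      (enumerates : ∀ v → v ≡ o ⊎ v ∈ ws) where

    point : ℚ → Valuation
    point t = (λ _ → 0ℚ) [ o ≔ t ]

    open Bounds o (λ _ → 0ℚ)

    projected : List Constraint
    projected = eliminateAll ws S

    projection : ∀ x → x ⊨* S → point (x o) ⊨* projected
    projection x x⊨S = ⊨*-cong projected agree (eliminateAll-sound ws S x x⊨S)
      where
        agree : ∀ v → zeroOut ws x v ≡ point (x o) v
        agree v with enumerates v
        ... | inj₁ refl = trans (zeroOut-∉ ws x o∉ws) (sym (≔-same _ o (x o)))
        ... | inj₂ v∈   = trans (zeroOut-∈ ws x v∈) (sym (≔-other _ (x o) (λ v≡o → o∉ws (subst (_∈ ws) v≡o v∈))))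

    sat-point : ∀ {a b} t → point t ⊨* projected → (a , b) ∈ projected → coeff o a * t + residual a ≤ b
    sat-point {a} {b} t t⊨ ab∈ = subst (_≤ b) (⟦⟧-≔ o a _ t) (t⊨ ab∈)

    module _ (M : ℚ) (bounded : ∀ x → x ⊨* S → x o ≤ M) (x₀ : Valuation) (x₀⊨S : x₀ ⊨* S) where

      t* : ℚ
      t* = min M (concatMap upperBound projected)

      ≤t* : ∀ t → point t ⊨* projected → t ≤ M → t ≤ t*
      ≤t* t t⊨ t≤M = v≤min⁺ t≤M (All.tabulate below)
        where
          below : ∀ {u} → u ∈ concatMap upperBound projected → t ≤ u
          below u∈ with find (∈-concatMap⁻ upperBound {projected} u∈)
          ... | _ , ab∈ , u∈a with upperBound⁻ u∈a
          ... | α>0 , refl = ≤⇒≤-bound-pos {{>-nonZero α>0}} α>0 (sat-point t t⊨ ab∈)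

      t₀≤t* : x₀ o ≤ t*
      t₀≤t* = ≤t* (x₀ o) (projection x₀ x₀⊨S) (bounded x₀ x₀⊨S)

      t*⊨ : point t* ⊨* projected
      t*⊨ {a , b} ab∈ with <-cmp (coeff o a) 0ℚ
      ... | tri< α<0 _ _ = subst (_≤ b) (sym (⟦⟧-≔ o a _ t*))
        (≤-trans (+-monoˡ-≤ (residual a) (*-monoˡ-≤-nonPos (coeff o a) {{nonPositive (<⇒≤ α<0)}} t₀≤t*))
                 (sat-point (x₀ o) (projection x₀ x₀⊨S) ab∈))
      ... | tri≈ _ α≡0 _ = subst (_≤ b) (sym (trans (⟦⟧-≔ o a _ t*) (α≡0⇒α*t+r≡r t* _ α≡0)))
        (subst (_≤ b) (α≡0⇒α*t+r≡r (x₀ o) _ α≡0) (sat-point (x₀ o) (projection x₀ x₀⊨S) ab∈))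
      ... | tri> _ _ α>0 = subst (_≤ b) (sym (⟦⟧-≔ o a _ t*))
        (≤-bound⇒≤-pos {{>-nonZero α>0}} α>0
          (min≤v⁺ M _ (inj₂ (lose (∈-concatMap⁺ upperBound {projected} (lose ab∈ (upperBound∋ α>0))) ≤-refl))))

      maximum-attained : ∃ λ x* → x* ⊨* S × (∀ x → x ⊨* S → x o ≤ x* o)
      maximum-attained with eliminateAll-complete ws S (point t*) o∉ws t*⊨
      ... | x* , x*⊨S , x*o≡t* = x* , x*⊨S , λ x x⊨S →
        subst (x o ≤_) (sym (trans x*o≡t* (≔-same _ o t*))) (≤t* (x o) (projection x x⊨S) (bounded x x⊨S))

-- The greedy z of a cluster

module Greedy (I : Instance) where
  open Instance I

  instance
    U≢0 : ∀ {l} → NonZero (U l)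
    U≢0 {l} = >-nonZero (U-pos l)

  capacityBelow : (l : Fin q) → ℕ → ℚ
  capacityBelow l = Σbelow (B l)

  profile : (l : Fin q) → ℕ → ℚ
  profile l t = capacityBelow l t ⊓ U l

  -- Laying the knapsacks of cluster l end to end in index order, share l k is the part of
  -- [0, U l] covered by knapsack k.
  share : (l : Fin q) → Fin (nK l) → ℚ
  share l k = profile l (suc (toℕ k)) - profile l (toℕ k)

  greedyZ : (l : Fin q) → Fin (nK l) → ℚ
  greedyZ l k = share l k ÷ U l

  capacityBelow-mono : ∀ l {s t} → s ℕ.≤ t → capacityBelow l s ≤ capacityBelow l t
  capacityBelow-mono l = Σbelow-monoʳ (λ k → <⇒≤ (B-pos l k))

  capacityBelow-suc : ∀ l k → capacityBelow l (suc (toℕ k)) ≡ capacityBelow l (toℕ k) + B l k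
  capacityBelow-suc l = Σbelow-suc (B l)

  profile-mono : ∀ l {s t} → s ℕ.≤ t → profile l s ≤ profile l t
  profile-mono l s≤t = ⊓-monoˡ-≤ (U l) (capacityBelow-mono l s≤t)

  profile-step : ∀ l (k : Fin (nK l)) → profile l (toℕ k) ≤ profile l (suc (toℕ k))
  profile-step l k = profile-mono l (ℕ.n≤1+n (toℕ k))

  profile-zero : ∀ l → profile l 0 ≡ 0ℚ
  profile-zero l = trans (cong (_⊓ U l) (Σbelow-zero (B l))) (p≤q⇒p⊓q≡p (<⇒≤ (U-pos l)))

  profile-all : ∀ l → profile l (nK l) ≡ U l
  profile-all l = trans (cong (_⊓ U l) (Σbelow-all (B l))) (p≥q⇒p⊓q≡q (<⇒≤ (U<ΣB l)))

  share-nonNeg : ∀ l k → 0ℚ ≤ share l k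
  share-nonNeg l k = p≤q⇒0≤q-p (profile-step l k)

  share≤B : ∀ l k → share l k ≤ B l k
  share≤B l k = subst (λ s → s ⊓ U l - profile l (toℕ k) ≤ B l k) (sym (capacityBelow-suc l k))
                      ([p+q]⊓r-p⊓r≤q (capacityBelow l (toℕ k)) (B l k) (U l) (<⇒≤ (B-pos l k)))

  Σshare≡U : ∀ l → Σℚ (share l) ≡ U l
  Σshare≡U l = begin-equality
    Σℚ (share l)                         ≡⟨ Σℚ-telescope (nK l) (profile l) ⟩
    profile l (nK l) - profile l 0       ≡⟨ cong₂ _-_ (profile-all l) (profile-zero l) ⟩
    U l - 0ℚ                             ≡⟨ +-identityʳ (U l) ⟩
    U l                                  ∎
    where open ≤-Reasoning

  U*greedyZ≡share : ∀ l k → U l * greedyZ l k ≡ share l k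
  U*greedyZ≡share l k = *-÷-cancel (U l) (share l k)

  ΣgreedyZ≡1 : ∀ l → Σℚ (greedyZ l) ≡ 1ℚ
  ΣgreedyZ≡1 l = trans (*-distribʳ-Σℚ (1/ U l) (share l))
                       (trans (cong (_* 1/ U l) (Σshare≡U l)) (*-inverseʳ (U l)))

  greedyZ-nonNeg : ∀ l k → 0ℚ ≤ greedyZ l k
  greedyZ-nonNeg l k = *-cancelˡ-≤-pos (U l) {{positive (U-pos l)}}
    (subst₂ _≤_ (sym (*-zeroʳ (U l))) (sym (U*greedyZ≡share l k)) (share-nonNeg l k))

  share-uncut : ∀ l k → capacityBelow l (suc (toℕ k)) ≤ U l → share l k ≡ B l k
  share-uncut l k below = begin-equality
    profile l (suc (toℕ k)) - profile l (toℕ k)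
      ≡⟨ cong₂ _-_ (p≤q⇒p⊓q≡p below) (p≤q⇒p⊓q≡p (≤-trans (capacityBelow-mono l (ℕ.n≤1+n (toℕ k))) below)) ⟩
    capacityBelow l (suc (toℕ k)) - capacityBelow l (toℕ k)
      ≡⟨ cong (_- capacityBelow l (toℕ k)) (capacityBelow-suc l k) ⟩
    (capacityBelow l (toℕ k) + B l k) - capacityBelow l (toℕ k)
      ≡⟨ [p+q]-p≡q (capacityBelow l (toℕ k)) (B l k) ⟩
    B l k ∎
    where open ≤-Reasoning

  share-cut : ∀ l k → capacityBelow l (toℕ k) ≤ U l → U l ≤ capacityBelow l (suc (toℕ k)) →
              share l k ≡ U l - capacityBelow l (toℕ k)
  share-cut l k below above = cong₂ _-_ (p≥q⇒p⊓q≡q above) (p≤q⇒p⊓q≡p below)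

  share-beyond : ∀ l k → U l ≤ capacityBelow l (toℕ k) → share l k ≡ 0ℚ
  share-beyond l k above = trans (cong₂ _-_ (p≥q⇒p⊓q≡q (≤-trans above (capacityBelow-mono l (ℕ.n≤1+n (toℕ k)))))
                                            (p≥q⇒p⊓q≡q above))
                                 (+-inverseʳ (U l))

  greedyZ-uncut : ∀ l (κ k : Fin (nK l)) → capacityBelow l (toℕ κ) ≤ U l → toℕ k ℕ.< toℕ κ → greedyZ l k ≡ B l k ÷ U l
  greedyZ-uncut l κ k below k<κ = cong (_÷ U l) (share-uncut l k (≤-trans (capacityBelow-mono l k<κ) below))

  greedyZ-shape : ∀ l κ → IsCritical I l κ → ∀ k →
    (toℕ k ℕ.< toℕ κ → greedyZ l k ≡ B l k ÷ U l) ×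
    (k ≡ κ → greedyZ l k ≡ 1ℚ - Σbelow (greedyZ l) (toℕ κ)) ×
    (toℕ κ ℕ.< toℕ k → greedyZ l k ≡ 0ℚ)
  greedyZ-shape l κ (below , above) k = greedyZ-uncut l κ k below , at , after
    where
      at : k ≡ κ → greedyZ l k ≡ 1ℚ - Σbelow (greedyZ l) (toℕ κ)
      at refl = begin-equality
        share l k ÷ U l                                 ≡⟨ cong (_÷ U l) (share-cut l k below (<⇒≤ above)) ⟩
        (U l - capacityBelow l (toℕ k)) * 1/ U l        ≡⟨ solve 3 (λ u s i → (u :- s) :* i := u :* i :- s :* i) refl
                                                                 (U l) (capacityBelow l (toℕ k)) (1/ U l) ⟩
        U l * 1/ U l - capacityBelow l (toℕ k) * 1/ U l ≡⟨ cong₂ _-_ (*-inverseʳ (U l)) (sym (*-distribʳ-Σbelow (1/ U l) (B l) (toℕ k))) ⟩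
        1ℚ - Σbelow (λ t → B l t ÷ U l) (toℕ k)         ≡⟨ cong (λ s → 1ℚ - s) (Σbelow-cong (toℕ k) (λ t t<k → sym (greedyZ-uncut l k t below t<k))) ⟩
        1ℚ - Σbelow (greedyZ l) (toℕ k)                 ∎
        where open ≤-Reasoning

      after : toℕ κ ℕ.< toℕ k → greedyZ l k ≡ 0ℚ
      after κ<k = trans (cong (_÷ U l) (share-beyond l k (≤-trans (<⇒≤ above) (capacityBelow-mono l κ<k))))
                        (*-zeroˡ (1/ U l))

-- Moving the load of a feasible point onto the greedy z

greedyPoint : (I : Instance) → (Fin (Instance.m I) → Knap I → ℚ) → (Fin (Instance.n I) → ℚ) → Point I
greedyPoint I x y = record { x = x ; y = y ; z = Greedy.greedyZ I }

module Rearrangement (I : Instance) (P : Point I) (feasible : Feasible I P) where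
  open Instance I
  open Point P
  open Feasible feasible
  open Greedy I

  L : (l : Fin q) → Fin (nK l) → ℚ
  L l k = load I P (l , k)

  loadBelow : (l : Fin q) → ℕ → ℚ
  loadBelow l = Σbelow (L l)

  cost*x-nonNeg : ∀ j K → 0ℚ ≤ cost j * x j K
  cost*x-nonNeg j K = subst (_≤ cost j * x j K) (*-zeroʳ (cost j))
    (*-monoˡ-≤-nonNeg (cost j) {{nonNegative (<⇒≤ (cost-pos j))}} (proj₁ (x-bounds j K)))

  L-nonNeg : ∀ l k → 0ℚ ≤ L l k
  L-nonNeg l k = Σℚ-nonNeg (λ j → cost*x-nonNeg j (l , k))

  ΣL≤U : ∀ l → Σℚ (L l) ≤ U l
  ΣL≤U l = begin
    Σℚ (L l)                ≤⟨ Σℚ-mono (cluster l) ⟩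
    Σℚ (λ k → U l * z l k)  ≡⟨ *-distribˡ-Σℚ (U l) (z l) ⟩
    U l * Σℚ (z l)          ≤⟨ *-monoˡ-≤-nonNeg (U l) {{nonNegative (<⇒≤ (U-pos l))}} (z-sum l) ⟩
    U l * 1ℚ                ≡⟨ *-identityʳ (U l) ⟩
    U l                     ∎
    where open ≤-Reasoning

  L≤0⇒x≡0 : ∀ j l k → L l k ≤ 0ℚ → x j (l , k) ≡ 0ℚ
  L≤0⇒x≡0 j l k L≤0 = ≤-antisym (*-cancelˡ-≤-pos (cost j) {{positive (cost-pos j)}} cost*x≤0) (proj₁ (x-bounds j (l , k)))
    where
      cost*x≤0 : cost j * x j (l , k) ≤ cost j * 0ℚ
      cost*x≤0 = ≤-trans (term≤Σℚ (λ j′ → cost*x-nonNeg j′ (l , k)) j) (≤-trans L≤0 (≤-reflexive (sym (*-zeroʳ (cost j)))))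

  loadBelow-nonNeg : ∀ l t → 0ℚ ≤ loadBelow l t
  loadBelow-nonNeg l t = Σbelow-nonNeg t (L-nonNeg l)

  loadBelow-step : ∀ l (k : Fin (nK l)) → loadBelow l (toℕ k) ≤ loadBelow l (suc (toℕ k))
  loadBelow-step l k = Σbelow-monoʳ (L-nonNeg l) (ℕ.n≤1+n (toℕ k))

  loadBelow-suc : ∀ l k → loadBelow l (suc (toℕ k)) - loadBelow l (toℕ k) ≡ L l k
  loadBelow-suc l k = trans (cong (_- loadBelow l (toℕ k)) (Σbelow-suc (L l) k)) ([p+q]-p≡q (loadBelow l (toℕ k)) (L l k))

  loadBelow≤U : ∀ l t → loadBelow l t ≤ U l
  loadBelow≤U l t = ≤-trans (Σbelow≤Σℚ t (L-nonNeg l)) (ΣL≤U l)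

  loadBelow≤profile : ∀ l t → loadBelow l t ≤ profile l t
  loadBelow≤profile l t = ⊓-glb (Σbelow-monoˡ t (λ k → knapsack (l , k))) (loadBelow≤U l t)

  transport : (l : Fin q) → Fin (nK l) → Fin (nK l) → ℚ
  transport l k′ k = overlapLength (loadBelow l (toℕ k′)) (loadBelow l (suc (toℕ k′)))
                                   (profile l (toℕ k)) (profile l (suc (toℕ k)))

  transport-nonNeg : ∀ l k′ k → 0ℚ ≤ transport l k′ k
  transport-nonNeg l k′ k = overlapLength-nonNeg (loadBelow l (toℕ k′)) (loadBelow l (suc (toℕ k′))) (profile-step l k)

  transport≤L : ∀ l k′ k → transport l k′ k ≤ L l k′
  transport≤L l k′ k = subst (transport l k′ k ≤_) (loadBelow-suc l k′) (overlapLength≤length _ _ (loadBelow-step l k′))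

  Σtransport-out : ∀ l k′ → Σℚ (transport l k′) ≡ L l k′
  Σtransport-out l k′ = begin-equality
    Σℚ (transport l k′)                        ≡⟨ Σℚ-telescope (nK l) (λ t → clamp a b (profile l t)) ⟩
    clamp a b (profile l (nK l)) - clamp a b (profile l 0)
      ≡⟨ cong₂ (λ s t → clamp a b s - clamp a b t) (profile-all l) (profile-zero l) ⟩
    clamp a b (U l) - clamp a b 0ℚ
      ≡⟨ cong₂ _-_ (clamp-above (loadBelow-step l k′) (loadBelow≤U l (suc (toℕ k′)))) (clamp-below (loadBelow-step l k′) (loadBelow-nonNeg l (toℕ k′))) ⟩
    b - a                                      ≡⟨ loadBelow-suc l k′ ⟩
    L l k′                                     ∎
    where
      open ≤-Reasoning
      a = loadBelow l (toℕ k′)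
      b = loadBelow l (suc (toℕ k′))

  Σtransport-in : ∀ l k → Σℚ (λ k′ → transport l k′ k) ≤ share l k
  Σtransport-in l k = begin
    Σℚ (λ k′ → transport l k′ k)
      ≡⟨ Σℚ-cong (λ k′ → overlapLength-comm (loadBelow-step l k′) (profile-step l k)) ⟩
    Σℚ {nK l} (λ k′ → overlapLength c d (loadBelow l (toℕ k′)) (loadBelow l (suc (toℕ k′))))
      ≡⟨ Σℚ-telescope (nK l) (λ t → clamp c d (loadBelow l t)) ⟩
    overlapLength c d (loadBelow l 0) (loadBelow l (nK l))
      ≤⟨ overlapLength≤length _ _ (profile-step l k) ⟩
    share l k ∎
    where
      open ≤-Reasoning
      c = profile l (toℕ k)
      d = profile l (suc (toℕ k))

  transport-upward : ∀ l k′ k → toℕ k′ ℕ.< toℕ k → transport l k′ k ≡ 0ℚ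
  transport-upward l k′ k k′<k = trans
    (cong₂ _-_ (clamp-above (loadBelow-step l k′) (≤-trans end≤ (profile-step l k)))
               (clamp-above (loadBelow-step l k′) end≤))
    (+-inverseʳ (loadBelow l (suc (toℕ k′))))
    where
      end≤ : loadBelow l (suc (toℕ k′)) ≤ profile l (toℕ k)
      end≤ = ≤-trans (loadBelow≤profile l (suc (toℕ k′))) (profile-mono l k′<k)

  -- An unloaded knapsack sends nothing; all its x vanish anyway, costs being positive.
  fraction : (l : Fin q) → Fin (nK l) → Fin (nK l) → ℚ
  fraction l k′ k with 0ℚ <? L l k′
  ... | yes L>0 = (transport l k′ k ÷ L l k′) {{>-nonZero L>0}}
  ... | no _    = 0ℚ

  fraction-nonNeg : ∀ l k′ k → 0ℚ ≤ fraction l k′ k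
  fraction-nonNeg l k′ k with 0ℚ <? L l k′
  ... | yes L>0 = *-cancelˡ-≤-pos (L l k′) {{positive L>0}}
        (subst₂ _≤_ (sym (*-zeroʳ (L l k′))) (sym (*-÷-cancel (L l k′) {{>-nonZero L>0}} _)) (transport-nonNeg l k′ k))
  ... | no _    = ≤-refl

  fraction-upward : ∀ l k′ k → toℕ k′ ℕ.< toℕ k → fraction l k′ k ≡ 0ℚ
  fraction-upward l k′ k k′<k with 0ℚ <? L l k′
  ... | yes L>0 = trans (cong (λ t → t * (1/ L l k′) {{>-nonZero L>0}}) (transport-upward l k′ k k′<k)) (*-zeroˡ ((1/ L l k′) {{>-nonZero L>0}}))
  ... | no _  = refl

  L*fraction≡transport : ∀ l k′ k → L l k′ * fraction l k′ k ≡ transport l k′ k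
  L*fraction≡transport l k′ k with 0ℚ <? L l k′
  ... | yes L>0 = *-÷-cancel (L l k′) {{>-nonZero L>0}} (transport l k′ k)
  ... | no L≯0  = trans (*-zeroʳ (L l k′))
        (≤-antisym (transport-nonNeg l k′ k) (≤-trans (transport≤L l k′ k) (≮⇒≥ L≯0)))

  x*Σfraction≡x : ∀ j l k′ → x j (l , k′) * Σℚ (fraction l k′) ≡ x j (l , k′)
  x*Σfraction≡x j l k′ with 0ℚ <? L l k′
  ... | yes L>0 = trans (cong (x j (l , k′) *_) Σfraction≡1) (*-identityʳ _)
    where
      Σfraction≡1 : Σℚ (λ k → transport l k′ k * (1/ L l k′) {{>-nonZero L>0}}) ≡ 1ℚ
      Σfraction≡1 = trans (*-distribʳ-Σℚ _ (transport l k′))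
                          (trans (cong (λ s → s * (1/ L l k′) {{>-nonZero L>0}}) (Σtransport-out l k′))
                                 (*-inverseʳ (L l k′) {{>-nonZero L>0}}))
  ... | no L≯0  = trans (cong (_* Σℚ {nK l} (λ _ → 0ℚ)) x≡0) (trans (*-zeroˡ (Σℚ {nK l} (λ _ → 0ℚ))) (sym x≡0))
    where x≡0 = L≤0⇒x≡0 j l k′ (≮⇒≥ L≯0)

  moved : Fin m → Knap I → ℚ
  moved j (l , k) = Σℚ (λ k′ → x j (l , k′) * fraction l k′ k)

  moved-nonNeg : ∀ j K → 0ℚ ≤ moved j K
  moved-nonNeg j (l , k) = Σℚ-nonNeg λ k′ → subst (_≤ x j (l , k′) * fraction l k′ k) (*-zeroʳ (x j (l , k′)))
    (*-monoˡ-≤-nonNeg (x j (l , k′)) {{nonNegative (proj₁ (x-bounds j (l , k′)))}} (fraction-nonNeg l k′ k))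

  ΣK-moved : ∀ j → ΣK I (moved j) ≡ ΣK I (x j)
  ΣK-moved j = Σℚ-cong λ l → begin-equality
    Σℚ (λ k → Σℚ (λ k′ → x j (l , k′) * fraction l k′ k))  ≡⟨ Σℚ-comm (λ k k′ → x j (l , k′) * fraction l k′ k) ⟩
    Σℚ (λ k′ → Σℚ (λ k → x j (l , k′) * fraction l k′ k))  ≡⟨ Σℚ-cong (λ k′ → trans (*-distribˡ-Σℚ (x j (l , k′)) (fraction l k′))
                                                                                      (x*Σfraction≡x j l k′)) ⟩
    Σℚ (λ k′ → x j (l , k′))                                ∎
    where open ≤-Reasoning

  load-moved≤share : ∀ l k → Σℚ (λ j → cost j * moved j (l , k)) ≤ share l k
  load-moved≤share l k = begin
    Σℚ (λ j → cost j * Σℚ (λ k′ → x j (l , k′) * fraction l k′ k))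
      ≡⟨ Σℚ-cong (λ j → sym (*-distribˡ-Σℚ (cost j) (λ k′ → x j (l , k′) * fraction l k′ k))) ⟩
    Σℚ (λ j → Σℚ (λ k′ → cost j * (x j (l , k′) * fraction l k′ k)))
      ≡⟨ Σℚ-comm (λ j k′ → cost j * (x j (l , k′) * fraction l k′ k)) ⟩
    Σℚ (λ k′ → Σℚ (λ j → cost j * (x j (l , k′) * fraction l k′ k)))
      ≡⟨ Σℚ-cong (λ k′ → trans (Σℚ-cong (λ j → sym (*-assoc (cost j) (x j (l , k′)) (fraction l k′ k))))
                                (*-distribʳ-Σℚ (fraction l k′ k) (λ j → cost j * x j (l , k′)))) ⟩
    Σℚ (λ k′ → L l k′ * fraction l k′ k)
      ≡⟨ Σℚ-cong (λ k′ → L*fraction≡transport l k′ k) ⟩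
    Σℚ (λ k′ → transport l k′ k)
      ≤⟨ Σtransport-in l k ⟩
    share l k ∎
    where open ≤-Reasoning

  moved-absent : ∀ j K → capOf I K < cost j → moved j K ≡ 0ℚ
  moved-absent j (l , k) B<c = trans (Σℚ-cong vanishes) (Σℚ-zero (nK l))
    where
      vanishes : ∀ k′ → x j (l , k′) * fraction l k′ k ≡ 0ℚ
      vanishes k′ with toℕ k′ ℕ.<? toℕ k
      ... | yes k′<k = trans (cong (x j (l , k′) *_) (fraction-upward l k′ k k′<k)) (*-zeroʳ (x j (l , k′)))
      ... | no k′≮k  = trans (cong (_* fraction l k′ k) (x-absent j (l , k′) (≤-<-trans (B-nonincr l k k′ (ℕ.≮⇒≥ k′≮k)) B<c)))
                             (*-zeroˡ (fraction l k′ k))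

  moved≤1 : ∀ j K → moved j K ≤ 1ℚ
  moved≤1 j (l , k) = begin
    moved j (l , k)                    ≤⟨ term≤Σℚ (λ k₁ → moved-nonNeg j (l , k₁)) k ⟩
    Σℚ (λ k₁ → moved j (l , k₁))       ≤⟨ term≤Σℚ (λ l₁ → Σℚ-nonNeg (λ k₁ → moved-nonNeg j (l₁ , k₁))) l ⟩
    ΣK I (moved j)                     ≡⟨ ΣK-moved j ⟩
    ΣK I (x j)                         ≤⟨ assign j ⟩
    1ℚ                                 ∎
    where open ≤-Reasoning

  moved-feasible : Feasible I (greedyPoint I moved y)
  moved-feasible = record
    { x-bounds = λ j K → moved-nonNeg j K , moved≤1 j K
    ; x-absent = moved-absent
    ; y-bounds = y-bounds
    ; z-nonneg = greedyZ-nonNeg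
    ; knapsack = λ (l , k) → ≤-trans (load-moved≤share l k) (share≤B l k)
    ; assign   = λ j → subst (_≤ 1ℚ) (sym (ΣK-moved j)) (assign j)
    ; cover    = λ i → subst (y i ≤_) (Σℚ-cong (λ j → covered (mem j i) j)) (cover i)
    ; cluster  = λ l k → subst (Σℚ (λ j → cost j * moved j (l , k)) ≤_) (sym (U*greedyZ≡share l k)) (load-moved≤share l k)
    ; z-sum    = λ l → ≤-reflexive (ΣgreedyZ≡1 l)
    }
    where
      covered : ∀ b j → (if b then ΣK I (x j) else 0ℚ) ≡ (if b then ΣK I (moved j) else 0ℚ)
      covered true  j = sym (ΣK-moved j)
      covered false j = refl

-- The relaxation with z fixed to the greedy z, as a system of linear constraints

module Encoding (I : Instance) where
  open Instance I
  open Greedy I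

  data Var : Set where
    xVar  : Fin m → Knap I → Var
    yVar  : Fin n → Var
    value : Var

  private
    code : Var → (Fin m × Knap I) ⊎ (Fin n ⊎ ⊤)
    code (xVar j K) = inj₁ (j , K)
    code (yVar i)   = inj₂ (inj₁ i)
    code value      = inj₂ (inj₂ tt)

    code-injective : ∀ {u v} → code u ≡ code v → u ≡ v
    code-injective {xVar _ _} {xVar _ _} refl = refl
    code-injective {yVar _}   {yVar _}   refl = refl
    code-injective {value}    {value}    refl = refl

  _≟ᵛ_ : DecidableEquality Var
  u ≟ᵛ v = map′ code-injective (cong code)
    (⊎.≡-dec (×.≡-dec Fin._≟_ (×.≡-dec Fin._≟_ Fin._≟_)) (⊎.≡-dec Fin._≟_ ⊤._≟_) (code u) (code v))

  open FourierMotzkin _≟ᵛ_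

  knaps : List (Knap I)
  knaps = concatMap (λ l → map (l ,_) (allFin (nK l))) (allFin q)

  ∈-knaps : ∀ K → K ∈ knaps
  ∈-knaps (l , k) = ∈-concatMap⁺ (λ l → map (l ,_) (allFin (nK l))) (lose (∈-allFin l) (∈-map⁺ (l ,_) (∈-allFin k)))

  decisionVars : List Var
  decisionVars = concatMap (λ K → map (λ j → xVar j K) (allFin m)) knaps ++ map yVar (allFin n)

  enumerates : ∀ v → v ≡ value ⊎ v ∈ decisionVars
  enumerates (xVar j K) = inj₂ (∈-++⁺ˡ (∈-concatMap⁺ (λ K → map (λ j → xVar j K) (allFin m))
                                         (lose (∈-knaps K) (∈-map⁺ (λ j → xVar j K) (∈-allFin j)))))
  enumerates (yVar i)   = inj₂ (∈-++⁺ʳ _ (∈-map⁺ yVar (∈-allFin i)))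
  enumerates value      = inj₁ refl

  value∉decisionVars : value ∉ decisionVars
  value∉decisionVars v∈ with ∈-++⁻ (concatMap (λ K → map (λ j → xVar j K) (allFin m)) knaps) v∈
  ... | inj₁ v∈x with find (∈-concatMap⁻ (λ K → map (λ j → xVar j K) (allFin m)) {knaps} v∈x)
  ...   | K , _ , v∈map with ∈-map⁻ (λ j → xVar j K) v∈map
  ...     | _ , _ , ()
  value∉decisionVars v∈ | inj₂ v∈y with ∈-map⁻ yVar v∈y
  ...   | _ , _ , ()

  var : Var → LinearForm
  var v = [ (v , 1ℚ) ]

  _⊖_ : LinearForm → LinearForm → LinearForm
  a ⊖ b = a ++ scale (- 1ℚ) b

  sum : ∀ {k} → (Fin k → LinearForm) → LinearForm
  sum {zero}  f = []
  sum {suc k} f = f Fin.zero ++ sum (λ i → f (Fin.suc i))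

  assigned : Fin m → LinearForm
  assigned j = sum λ l → sum λ k → var (xVar j (l , k))

  loadOf : Knap I → LinearForm
  loadOf K = sum λ j → [ (xVar j K , cost j) ]

  coverage : Fin n → LinearForm
  coverage i = sum λ j → if mem j i then assigned j else []

  profitOf : LinearForm
  profitOf = sum λ i → [ (yVar i , profit i) ]

  ⟦var⟧ : ∀ v x → ⟦ var v ⟧ x ≡ x v
  ⟦var⟧ v x = trans (+-identityʳ _) (*-identityˡ (x v))

  ⟦⊖⟧ : ∀ a b x → ⟦ a ⊖ b ⟧ x ≡ ⟦ a ⟧ x - ⟦ b ⟧ x
  ⟦⊖⟧ a b x = trans (⟦++⟧ a (scale (- 1ℚ) b) x)
    (cong (⟦ a ⟧ x +_) (trans (⟦scale⟧ (- 1ℚ) b x) (trans (sym (neg-distribˡ-* 1ℚ (⟦ b ⟧ x))) (cong -_ (*-identityˡ (⟦ b ⟧ x))))))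

  ⟦sum⟧ : ∀ {k} (f : Fin k → LinearForm) x → ⟦ sum f ⟧ x ≡ Σℚ (λ i → ⟦ f i ⟧ x)
  ⟦sum⟧ {zero}  f x = refl
  ⟦sum⟧ {suc k} f x = trans (⟦++⟧ (f Fin.zero) _ x) (cong (⟦ f Fin.zero ⟧ x +_) (⟦sum⟧ (λ i → f (Fin.suc i)) x))

  ⟦single⟧ : ∀ v c x → ⟦ [ (v , c) ] ⟧ x ≡ c * x v
  ⟦single⟧ v c x = +-identityʳ (c * x v)

  ⟦assigned⟧ : ∀ j x → ⟦ assigned j ⟧ x ≡ ΣK I (λ K → x (xVar j K))
  ⟦assigned⟧ j x = trans (⟦sum⟧ (λ l → sum λ k → var (xVar j (l , k))) x) (Σℚ-cong λ l → trans (⟦sum⟧ (λ k → var (xVar j (l , k))) x) (Σℚ-cong λ k → ⟦var⟧ (xVar j (l , k)) x))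

  ⟦loadOf⟧ : ∀ K x → ⟦ loadOf K ⟧ x ≡ Σℚ (λ j → cost j * x (xVar j K))
  ⟦loadOf⟧ K x = trans (⟦sum⟧ (λ j → [ (xVar j K , cost j) ]) x) (Σℚ-cong λ j → ⟦single⟧ (xVar j K) (cost j) x)

  ⟦coverage⟧ : ∀ i x → ⟦ coverage i ⟧ x ≡ Σℚ (λ j → if mem j i then ΣK I (λ K → x (xVar j K)) else 0ℚ)
  ⟦coverage⟧ i x = trans (⟦sum⟧ (λ j → if mem j i then assigned j else []) x) (Σℚ-cong λ j → ⟦if⟧ (mem j i) j)
    where
      ⟦if⟧ : ∀ b j → ⟦ if b then assigned j else [] ⟧ x ≡ (if b then ΣK I (λ K → x (xVar j K)) else 0ℚ)
      ⟦if⟧ true  j = ⟦assigned⟧ j x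
      ⟦if⟧ false j = refl

  ⟦profitOf⟧ : ∀ x → ⟦ profitOf ⟧ x ≡ Σℚ (λ i → profit i * x (yVar i))
  ⟦profitOf⟧ x = trans (⟦sum⟧ (λ i → [ (yVar i , profit i) ]) x) (Σℚ-cong λ i → ⟦single⟧ (yVar i) (profit i) x)

  absentIf : ∀ {A : Set} → Dec A → ℚ
  absentIf (yes _) = 0ℚ
  absentIf (no _)  = 1ℚ

  -- The upper bound 0 encodes the absence of x_jK when B_k < c_j.
  xBound : Fin m → Knap I → ℚ
  xBound j K = absentIf (capOf I K <? cost j)

  data Row : Set where
    x-lower x-upper : Fin m → Knap I → Row
    y-lower y-upper cover-row : Fin n → Row
    cluster-row : Knap I → Row
    assign-row : Fin m → Row
    objective-row : Row

  row : Row → Constraint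
  row (x-lower j K) = [] ⊖ var (xVar j K) , 0ℚ
  row (x-upper j K) = var (xVar j K) , xBound j K
  row (y-lower i)   = [] ⊖ var (yVar i) , 0ℚ
  row (y-upper i)   = var (yVar i) , 1ℚ
  row (cover-row i)     = var (yVar i) ⊖ coverage i , 0ℚ
  row (cluster-row (l , k)) = loadOf (l , k) , U l * greedyZ l k
  row (assign-row j)    = assigned j , 1ℚ
  row objective-row = var value ⊖ profitOf , 0ℚ

  yRows : Fin n → List Row
  yRows i = y-lower i ∷ y-upper i ∷ cover-row i ∷ []

  xRows : Knap I → Fin m → List Row
  xRows K j = x-lower j K ∷ x-upper j K ∷ []

  knapRows : Knap I → List Row
  knapRows K = cluster-row K ∷ concatMap (xRows K) (allFin m)

  rows : List Row
  rows = objective-row ∷ map assign-row (allFin m) ++ concatMap yRows (allFin n) ++ concatMap knapRows knaps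

  ∈-rows : ∀ r → r ∈ rows
  ∈-rows objective-row = here refl
  ∈-rows (assign-row j)    = there (∈-++⁺ˡ (∈-map⁺ assign-row (∈-allFin j)))
  ∈-rows (y-lower i)   = there (∈-++⁺ʳ (map assign-row (allFin m)) (∈-++⁺ˡ (∈-concatMap⁺ yRows (lose (∈-allFin i) (here refl)))))
  ∈-rows (y-upper i)   = there (∈-++⁺ʳ (map assign-row (allFin m)) (∈-++⁺ˡ (∈-concatMap⁺ yRows (lose (∈-allFin i) (there (here refl))))))
  ∈-rows (cover-row i)     = there (∈-++⁺ʳ (map assign-row (allFin m)) (∈-++⁺ˡ (∈-concatMap⁺ yRows (lose (∈-allFin i) (there (there (here refl)))))))
  ∈-rows (cluster-row K)   = there (∈-++⁺ʳ (map assign-row (allFin m)) (∈-++⁺ʳ (concatMap yRows (allFin n)) (∈-concatMap⁺ knapRows (lose (∈-knaps K) (here refl)))))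
  ∈-rows (x-lower j K) = there (∈-++⁺ʳ (map assign-row (allFin m)) (∈-++⁺ʳ (concatMap yRows (allFin n)) (∈-concatMap⁺ knapRows (lose (∈-knaps K)
                           (there (∈-concatMap⁺ (xRows K) (lose (∈-allFin j) (here refl))))))))
  ∈-rows (x-upper j K) = there (∈-++⁺ʳ (map assign-row (allFin m)) (∈-++⁺ʳ (concatMap yRows (allFin n)) (∈-concatMap⁺ knapRows (lose (∈-knaps K)
                           (there (∈-concatMap⁺ (xRows K) (lose (∈-allFin j) (there (here refl)))))))))

  system : List Constraint
  system = map row rows

  ⊨system : ∀ {x} → (∀ r → x ⊨ row r) → x ⊨* system
  ⊨system x⊨rows c∈ with ∈-map⁻ row {xs = rows} c∈
  ... | r , _ , refl = x⊨rows r

  ⊨row : ∀ {x} → x ⊨* system → ∀ r → x ⊨ row r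
  ⊨row x⊨ r = x⊨ (∈-map⁺ row (∈-rows r))

  xBound-absent : ∀ j K → capOf I K < cost j → xBound j K ≡ 0ℚ
  xBound-absent j K B<c with capOf I K <? cost j
  ... | yes _  = refl
  ... | no B≮c = contradiction B<c B≮c

  xBound≤1 : ∀ j K → xBound j K ≤ 1ℚ
  xBound≤1 j K with capOf I K <? cost j
  ... | yes _ = 0≤1
  ... | no _  = ≤-refl

  decode : Valuation → Point I
  decode x = greedyPoint I (λ j K → x (xVar j K)) (λ i → x (yVar i))

  encode : (Fin m → Knap I → ℚ) → (Fin n → ℚ) → ℚ → Valuation
  encode X Y o (xVar j K) = X j K
  encode X Y o (yVar i)   = Y i
  encode X Y o value      = o

  ⊨system⇒feasible : ∀ x → x ⊨* system → Feasible I (decode x) × x value ≤ objective I (decode x)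
  ⊨system⇒feasible x x⊨ = feasible , value≤objective
    where
      below : ∀ a b → x ⊨ (a ⊖ b , 0ℚ) → ⟦ a ⟧ x ≤ ⟦ b ⟧ x
      below a b h = p-q≤0⇒p≤q (subst (_≤ 0ℚ) (⟦⊖⟧ a b x) h)

      atLeast0 : ∀ v → x ⊨ ([] ⊖ var v , 0ℚ) → 0ℚ ≤ x v
      atLeast0 v h = subst (0ℚ ≤_) (⟦var⟧ v x) (below [] (var v) h)

      atMost : ∀ v {c} → x ⊨ (var v , c) → x v ≤ c
      atMost v {c} h = subst (_≤ c) (⟦var⟧ v x) h

      x-atLeast0 : ∀ j K → 0ℚ ≤ x (xVar j K)
      x-atLeast0 j K = atLeast0 (xVar j K) (⊨row x⊨ (x-lower j K))

      x≤xBound : ∀ j K → x (xVar j K) ≤ xBound j K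
      x≤xBound j K = atMost (xVar j K) (⊨row x⊨ (x-upper j K))

      load≤share : ∀ l k → load I (decode x) (l , k) ≤ share l k
      load≤share l k = subst₂ _≤_ (⟦loadOf⟧ (l , k) x) (U*greedyZ≡share l k) (⊨row x⊨ (cluster-row (l , k)))

      feasible : Feasible I (decode x)
      feasible = record
        { x-bounds = λ j K → x-atLeast0 j K , ≤-trans (x≤xBound j K) (xBound≤1 j K)
        ; x-absent = λ j K B<c → ≤-antisym (subst (x (xVar j K) ≤_) (xBound-absent j K B<c) (x≤xBound j K)) (x-atLeast0 j K)
        ; y-bounds = λ i → atLeast0 (yVar i) (⊨row x⊨ (y-lower i)) , atMost (yVar i) (⊨row x⊨ (y-upper i))
        ; z-nonneg = greedyZ-nonNeg
        ; knapsack = λ (l , k) → ≤-trans (load≤share l k) (share≤B l k)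
        ; assign   = λ j → subst (_≤ 1ℚ) (⟦assigned⟧ j x) (⊨row x⊨ (assign-row j))
        ; cover    = λ i → subst₂ _≤_ (⟦var⟧ (yVar i) x) (⟦coverage⟧ i x) (below (var (yVar i)) (coverage i) (⊨row x⊨ (cover-row i)))
        ; cluster  = λ l k → subst (load I (decode x) (l , k) ≤_) (sym (U*greedyZ≡share l k)) (load≤share l k)
        ; z-sum    = λ l → ≤-reflexive (ΣgreedyZ≡1 l)
        }

      value≤objective : x value ≤ objective I (decode x)
      value≤objective = subst₂ _≤_ (⟦var⟧ value x) (⟦profitOf⟧ x) (below (var value) profitOf (⊨row x⊨ objective-row))

  feasible⇒⊨system : ∀ X Y o → Feasible I (greedyPoint I X Y) → o ≤ objective I (greedyPoint I X Y) →
                     encode X Y o ⊨* system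
  feasible⇒⊨system X Y o feasible o≤objective = ⊨system holds
    where
      module F = Feasible feasible
      x = encode X Y o

      above : ∀ a b → ⟦ a ⟧ x ≤ ⟦ b ⟧ x → x ⊨ (a ⊖ b , 0ℚ)
      above a b h = subst (_≤ 0ℚ) (sym (⟦⊖⟧ a b x)) (p≤q⇒p-q≤0 h)

      atLeast0 : ∀ v → 0ℚ ≤ x v → x ⊨ ([] ⊖ var v , 0ℚ)
      atLeast0 v h = above [] (var v) (subst (0ℚ ≤_) (sym (⟦var⟧ v x)) h)

      atMost : ∀ v {c} → x v ≤ c → x ⊨ (var v , c)
      atMost v {c} h = subst (_≤ c) (sym (⟦var⟧ v x)) h

      X≤xBound : ∀ j K → X j K ≤ xBound j K
      X≤xBound j K with capOf I K <? cost j
      ... | yes B<c = ≤-reflexive (F.x-absent j K B<c)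
      ... | no _    = proj₂ (F.x-bounds j K)

      holds : ∀ r → x ⊨ row r
      holds (x-lower j K)     = atLeast0 (xVar j K) (proj₁ (F.x-bounds j K))
      holds (x-upper j K)     = atMost (xVar j K) (X≤xBound j K)
      holds (y-lower i)       = atLeast0 (yVar i) (proj₁ (F.y-bounds i))
      holds (y-upper i)       = atMost (yVar i) (proj₂ (F.y-bounds i))
      holds (cover-row i)         = above (var (yVar i)) (coverage i)
                                  (subst₂ _≤_ (sym (⟦var⟧ (yVar i) x)) (sym (⟦coverage⟧ i x)) (F.cover i))
      holds (cluster-row (l , k)) = subst (_≤ U l * greedyZ l k) (sym (⟦loadOf⟧ (l , k) x)) (F.cluster l k)
      holds (assign-row j)        = subst (_≤ 1ℚ) (sym (⟦assigned⟧ j x)) (F.assign j)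
      holds objective-row     = above (var value) profitOf
                                  (subst₂ _≤_ (sym (⟦var⟧ value x)) (sym (⟦profitOf⟧ x)) o≤objective)

objective≤Σprofit : ∀ I {P} → Feasible I P → objective I P ≤ Σℚ (Instance.profit I)
objective≤Σprofit I {P} feasible = Σℚ-mono λ i →
  ≤-trans (*-monoˡ-≤-nonNeg (profit i) {{nonNegative (<⇒≤ (profit-pos i))}} (proj₂ (y-bounds i)))
          (≤-reflexive (*-identityʳ (profit i)))
  where
    open Instance I
    open Feasible feasible

zero-feasible : ∀ I → Feasible I (greedyPoint I (λ _ _ → 0ℚ) (λ _ → 0ℚ))
zero-feasible I = record
  { x-bounds = λ _ _ → ≤-refl , 0≤1
  ; x-absent = λ _ _ _ → refl
  ; y-bounds = λ _ → ≤-refl , 0≤1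
  ; z-nonneg = greedyZ-nonNeg
  ; knapsack = λ (l , k) → subst (_≤ B l k) (sym no-load) (<⇒≤ (B-pos l k))
  ; assign   = λ _ → subst (_≤ 1ℚ) (sym ΣK-zero) 0≤1
  ; cover    = λ i → Σℚ-nonNeg λ j → uncovered (mem j i)
  ; cluster  = λ l k → subst₂ _≤_ (sym no-load) (sym (U*greedyZ≡share l k)) (share-nonNeg l k)
  ; z-sum    = λ l → ≤-reflexive (ΣgreedyZ≡1 l)
  }
  where
    open Instance I
    open Greedy I

    no-load : Σℚ (λ j → cost j * 0ℚ) ≡ 0ℚ
    no-load = trans (Σℚ-cong (λ j → *-zeroʳ (cost j))) (Σℚ-zero m)

    ΣK-zero : ΣK I (λ _ → 0ℚ) ≡ 0ℚ
    ΣK-zero = trans (Σℚ-cong (λ l → Σℚ-zero (nK l))) (Σℚ-zero q)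

    uncovered : ∀ b → 0ℚ ≤ (if b then ΣK I (λ _ → 0ℚ) else 0ℚ)
    uncovered true  = ≤-reflexive (sym ΣK-zero)
    uncovered false = ≤-refl

lemma5 : (I : Instance) →
    Σ (Point I) (λ P → Optimal I P ×
      (∀ (l : Fin (Instance.q I)) (κ : Fin (Instance.nK I l)) →
        IsCritical I l κ → zShape I P l κ))
lemma5 I = decode x* , (feasible* , optimal) , greedyZ-shape
  where
    open Instance I using (profit)
    open Greedy I
    open Encoding I
    open FourierMotzkin _≟ᵛ_

    bounded : ∀ x → x ⊨* system → x value ≤ Σℚ profit
    bounded x x⊨ = ≤-trans (proj₂ (⊨system⇒feasible x x⊨)) (objective≤Σprofit I (proj₁ (⊨system⇒feasible x x⊨)))

    zero⊨system : encode (λ _ _ → 0ℚ) (λ _ → 0ℚ) 0ℚ ⊨* system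
    zero⊨system = feasible⇒⊨system _ _ 0ℚ (zero-feasible I) (Σℚ-nonNeg λ i → ≤-reflexive (sym (*-zeroʳ (profit i))))

    maximum : ∃ λ x* → x* ⊨* system × (∀ x → x ⊨* system → x value ≤ x* value)
    maximum = Maximisation.maximum-attained system value decisionVars value∉decisionVars enumerates
                (Σℚ profit) bounded _ zero⊨system

    x* : Valuation
    x* = proj₁ maximum

    feasible* : Feasible I (decode x*)
    feasible* = proj₁ (⊨system⇒feasible x* (proj₁ (proj₂ maximum)))

    optimal : ∀ P → Feasible I P → objective I P ≤ objective I (decode x*)
    optimal P feasible = ≤-trans
      (proj₂ (proj₂ maximum) _ (feasible⇒⊨system moved (Point.y P) (objective I P) moved-feasible ≤-refl))
      (proj₂ (⊨system⇒feasible x* (proj₁ (proj₂ maximum))))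
      where open Rearrangement I P feasible
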